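{- Let $\mathcal{A}$ be a path object and let $\mathcal{B}(x)$ be a path object for each $x:|\mathcal{A}|$. Assuming dependent function extensionality, the type of oplax covariant lens structures on $\mathcal{B}$ over $\mathcal{A}$, namely $$\sum_{\Phi:\prod_{x,y:|\mathcal{A}|}\prod_{p:x\approx_{\mathcal{A}}y}|\mathcal{B}(x)|\to|\mathcal{B}(y)|}\ \prod_{x:|\mathcal{A}|}\prod_{u:|\mathcal{B}(x)|}\Phi\,x\,x\,(\mathsf{rx}_{\mathcal{A}}(x))\,u\approx_{\mathcal{B}(x)}u,$$ is a proposition.
   Context: Intensional Martin-Löf type theory with $\Pi,\Sigma$, identity types. A reflexive graph $\mathcal{G}$ consists of a type $|\mathcal{G}|$, edge types $x\approx_{\mathcal{G}}y$ for $x,y:|\mathcal{G}|$ and $\mathsf{rx}_{\mathcal{G}}(x):x\approx_{\mathcal{G}}x$. It is a path object (univalent) if for every $x$ the fan $\sum_{y:|\mathcal{G}|}x\approx_{\mathcal{G}}y$ is a proposition. -}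

module Defs where

open import Level using (Level; _⊔_; suc)
open import Data.Product using (Σ; _,_)
open import Relation.Binary.PropositionalEquality using (_≡_)

isProp : ∀ {ℓ} → Set ℓ → Set ℓ
isProp A = (x y : A) → x ≡ y

record ReflGraph (ℓ ℓ' : Level) : Set (suc (ℓ ⊔ ℓ')) where
  field
    ∣_∣ : Set ℓ
    _≈_ : ∣_∣ → ∣_∣ → Set ℓ'
    rx  : (x : ∣_∣) → x ≈ x

open ReflGraph public

isPathObject : ∀ {ℓ ℓ'} → ReflGraph ℓ ℓ' → Set (ℓ ⊔ ℓ')
isPathObject G = (x : ∣ G ∣) → isProp (Σ ∣ G ∣ λ y → _≈_ G x y)

OplaxCovLensStr : ∀ {a a' b b'} (A : ReflGraph a a') (B : ∣ A ∣ → ReflGraph b b')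
  → Set (a ⊔ a' ⊔ b ⊔ b')
OplaxCovLensStr A B =
  Σ ((x y : ∣ A ∣) → _≈_ A x y → ∣ B x ∣ → ∣ B y ∣) λ Φ →
    (x : ∣ A ∣) (u : ∣ B x ∣) → _≈_ (B x) (Φ x x (rx A x) u) u

-- In a path object every fan is a singleton, so edges support an induction
-- principle: to prove something about all edges out of x it suffices to treat
-- rx x. Hence a transport structure Φ is determined by its values on
-- reflexivity edges. These are fixed as well: Φ x x (rx x) u ≈ u puts
-- Φ x x (rx x) u in the cofan over u, which is again a proposition. Finally the
-- witnesses of the unit law live in edge types, which are propositions.
module Submission where

open import Level using (_⊔_)
open import Defs
open import Axiom.Extensionality.Propositional using (Extensionality)
open import Data.Product using (Σ; _,_; proj₁; proj₂)
open import Data.Product.Properties using (Σ-≡,≡→≡)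
open import Relation.Binary.PropositionalEquality
  using (_≡_; refl; sym; trans; cong; subst)

module PathObject {ℓ ℓ'} (G : ReflGraph ℓ ℓ') (isPO : isPathObject G) where

  ≈-elim : ∀ {p} {x : ∣ G ∣} (P : (y : ∣ G ∣) → _≈_ G x y → Set p) →
    P x (rx G x) → (y : ∣ G ∣) (e : _≈_ G x y) → P y e
  ≈-elim {x = x} P Prx y e =
    subst (λ w → P (proj₁ w) (proj₂ w)) (isPO x (x , rx G x) (y , e)) Prx

  ≈-isProp : (x y : ∣ G ∣) → isProp (_≈_ G x y)
  ≈-isProp x y e e' with isPO x (y , e) (y , e')
  ... | refl = refl

  Cofan : ∣ G ∣ → Set (ℓ ⊔ ℓ')
  Cofan y = Σ ∣ G ∣ λ x → _≈_ G x y

  cofan-isProp : (y : ∣ G ∣) → isProp (Cofan y)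
  cofan-isProp y (x , e) (x' , e') = trans (toRx x y e) (sym (toRx x' y e'))
    where
    toRx : (x y : ∣ G ∣) (e : _≈_ G x y) → _≡_ {A = Cofan y} (x , e) (y , rx G y)
    toRx x = ≈-elim (λ y e → _≡_ {A = Cofan y} (x , e) (y , rx G y)) refl

  ≡-onRx⇒≡ : ∀ {c} (funext : ∀ {ℓ ℓ'} → Extensionality ℓ ℓ')
    {C : (x y : ∣ G ∣) → _≈_ G x y → Set c}
    (f g : (x y : ∣ G ∣) (e : _≈_ G x y) → C x y e) →
    ((x : ∣ G ∣) → f x x (rx G x) ≡ g x x (rx G x)) → f ≡ g
  ≡-onRx⇒≡ funext f g onRx = funext λ x → funext λ y → funext λ e →
    ≈-elim (λ y e → f x y e ≡ g x y e) (onRx x) y e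

open PathObject

mainTheorem9 : ∀ {a a' b b'} → (funext : ∀ {ℓ ℓ'} → Extensionality ℓ ℓ')
    → (A : ReflGraph a a') → isPathObject A
    → (B : ∣ A ∣ → ReflGraph b b') → ((x : ∣ A ∣) → isPathObject (B x))
    → isProp (OplaxCovLensStr A B)
mainTheorem9 funext A isPO-A B isPO-B (Φ , h) (Ψ , k) = Σ-≡,≡→≡ (Φ≡Ψ , h≡k)
  where
  Φ≡Ψ : Φ ≡ Ψ
  Φ≡Ψ = ≡-onRx⇒≡ A isPO-A funext Φ Ψ λ x → funext λ u →
    cong proj₁ (cofan-isProp (B x) (isPO-B x) u (_ , h x u) (_ , k x u))

  h≡k : subst _ Φ≡Ψ h ≡ k
  h≡k = funext λ x → funext λ u → ≈-isProp (B x) (isPO-B x) _ _ _ (k x u)
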